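{- Let $k\in\mathbb{N}$ with $\gcd(k,6)=2$, let $h$ be an integer coprime to $k$, and let $h'$ be an integer with $hh'\equiv -1\pmod{4k}$ and $3\mid h'$. Then $$\frac{\omega_{3h,\frac{k}{2}}\omega_{h,\frac{k}{2}}\omega_{h,k}}{\omega_{3h,k}}=e^{ \frac{2\pi i}{36k} \left( h \left(9+9k \right) + h'\left(-5+2k^2 \right) \right)}\qquad\text{and}\qquad \frac{\omega_{3h,k}\omega_{h,\frac{k}{2}}\omega_{h,k}}{\omega_{3h,\frac{k}{2}}^3} =-e^{ -\frac{2\pi i}{18k} \left(h \left( 9+9k\right) + h'\left(1-k^2 \right) \right)}.$$
   Context: For coprime integers $h,K$ with $K\ge1$, let $h^\ast$ be any integer with $hh^\ast\equiv -1 \pmod K$ and set $$\omega_{h,K}:= \begin{cases} \left(\frac{ -K}{h} \right) e^{ -\pi i \left( \frac{1}{4}(2-hK-h)+\frac{1}{12}\left(K -\frac{1}{K} \right) \left(2h-h^\ast+h^2h^\ast\right)\right)}& \text{if } h \text{ is odd},\\ \left( \frac{ -h}{K} \right) e^{ -\pi i \left(\frac{1}{4}(K-1)+\frac{1}{12}\left(K-\frac{1}{K}\right) \left(2h-h^\ast+h^2h^\ast\right)\right) }& \text{if } K \text{ is odd},\end{cases}$$ with $\left(\frac{\cdot}{\cdot}\right)$ the Kronecker symbol (the standard eta-multiplier $e^{\pi i s(h,K)}$, $s$ the Dedekind sum; independent of the choice of $h^\ast$). -}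

module Defs where

open import Data.Bool using (Bool; true; false; if_then_else_; _∧_; _∨_)
open import Data.Nat as ℕ using (ℕ; zero; suc; _≡ᵇ_)
open import Data.Nat.DivMod as ℕD using ()
open import Data.Nat.Divisibility using (_∣?_)
open import Data.Nat.Primality using (prime?)
open import Data.Integer as ℤ using (ℤ; +_; -[1+_]; _%ℕ_; ∣_∣)
open import Data.Rational.Unnormalised as Q using (ℚᵘ; _≃_)
open import Data.Product using (∃)
open import Relation.Nullary using (does)

-1ℤ' : ℤ
-1ℤ' = -[1+ 0 ]

legendre : ℤ → ℕ → ℤ
legendre a zero = + 0
legendre a (suc p') =
  let p = suc p'
      r = (+ ((a %ℕ p) ℕ.^ ℕ.⌊ p' /2⌋)) %ℕ p
  in if r ≡ᵇ 0 then + 0 else (if r ≡ᵇ 1 then + 1 else -1ℤ')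

kron2 : ℤ → ℤ
kron2 a =
  let r = a %ℕ 8
  in if (r ≡ᵇ 1) ∨ (r ≡ᵇ 7) then + 1
     else (if (r ≡ᵇ 3) ∨ (r ≡ᵇ 5) then -1ℤ' else + 0)

kronPrime : ℤ → ℕ → ℤ
kronPrime a p = if p ≡ᵇ 2 then kron2 a else legendre a p

-- p-adic valuation of m (with fuel; fuel m suffices for p ≥ 2, m ≥ 1)
valF : ℕ → ℕ → ℕ → ℕ
valF zero p m = 0
valF (suc f) zero m = 0
valF (suc f) (suc zero) m = 0
valF (suc f) (suc (suc p')) zero = 0
valF (suc f) (suc (suc p')) (suc m') =
  if does (suc (suc p') ∣? suc m')
  then suc (valF f (suc (suc p')) (suc m' ℕD./ suc (suc p')))
  else 0

val : ℕ → ℕ → ℕ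
val p m = valF m p m

kronProd : ℤ → ℕ → ℕ → ℤ
kronProd a m zero = + 1
kronProd a m (suc q) =
  kronProd a m q ℤ.* (if does (prime? (suc q)) then kronPrime a (suc q) ℤ.^ val (suc q) m else + 1)

kronNat : ℤ → ℕ → ℤ
kronNat a zero = if ∣ a ∣ ≡ᵇ 1 then + 1 else + 0
kronNat a (suc m') = kronProd a (suc m') (suc m')

kronecker : ℤ → ℤ → ℤ
kronecker a (+ m) = kronNat a m
kronecker a -[1+ m ] =
  kronNeg a ℤ.* kronNat a (suc m)
  where
  kronNeg : ℤ → ℤ
  kronNeg (+ _) = + 1
  kronNeg -[1+ _ ] = -1ℤ'

-- Roots of unity e^{2πi x} are represented by their exponent x ∈ ℚ,
-- taken modulo 1.  Products of roots of unity correspond to sums.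

_≡₁_ : ℚᵘ → ℚᵘ → Set
x ≡₁ y = ∃ λ (z : ℤ) → x Q.- y ≃ z Q./ 1

infix 4 _≡₁_

-- the fraction n / d (as a rational), with the junk value 0 when d = 0
frac : ℤ → ℕ → ℚᵘ
frac n zero = Q.0ℚᵘ
frac n (suc d) = n Q./ suc d

-- exponent of a sign ε ∈ {1, -1}: 1 = e^{2πi·0}, -1 = e^{2πi·1/2}
-- (the value 0 of the Kronecker symbol never occurs for coprime h, K)
signExp : ℤ → ℚᵘ
signExp (+ _) = Q.0ℚᵘ
signExp -[1+ _ ] = frac (+ 1) 2

-- a fixed choice of h* with h h* ≡ -1 (mod K): least such h* in [0, K)
searchStar : ℤ → ℕ → ℕ → ℕ
searchStar h K zero = 0
searchStar h zero (suc n) = 0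
searchStar h (suc K') (suc n) =
  let c = K' ∸' n
  in if ((h ℤ.* + c ℤ.+ + 1) %ℕ suc K') ≡ᵇ 0 then c else searchStar h (suc K') n
  where
  _∸'_ : ℕ → ℕ → ℕ
  _∸'_ = ℕ._∸_

hStar : ℤ → ℕ → ℤ
hStar h K = + searchStar h K K

isOdd : ℤ → Bool
isOdd h = (h %ℕ 2) ≡ᵇ 1

-- ω_{h,K} = e^{2πi · omegaExp h K}   (for h, K coprime, K ≥ 1)
-- first case (h odd):   (-K/h) e^{-πi( (2-hK-h)/4 + (K-1/K)(2h-h*+h²h*)/12 )}
-- second case (else, K odd): (-h/K) e^{-πi( (K-1)/4 + (K-1/K)(2h-h*+h²h*)/12 )}
omegaExp : ℤ → ℕ → ℚᵘ
omegaExp h K =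
  let hs  = hStar h K
      Kz  = + K
      B   = (frac Kz 1 Q.- frac (+ 1) K) Q.* frac (ℤ._+_ (ℤ._-_ (+ 2 ℤ.* h) hs) (h ℤ.* h ℤ.* hs)) 12
  in if isOdd h
     then signExp (kronecker (ℤ.- Kz) h)
          Q.- frac (+ 1) 2 Q.* (frac (+ 2 ℤ.- h ℤ.* Kz ℤ.- h) 4 Q.+ B)
     else signExp (kronecker (ℤ.- h) Kz)
          Q.- frac (+ 1) 2 Q.* (frac (Kz ℤ.- + 1) 4 Q.+ B)

{-# OPTIONS --safe #-}
-- All four symbols are ω_{h,K} with h odd, so their exponents come from the first formula. Multiplied
-- by 96K, such an exponent is 48K b minus an integer polynomial in h, K and h*, where b ∈ {0, 1} is the
-- sign bit of the Kronecker symbol (-K/h). As 24 ∣ (h² - 1)(K² - 1) for h odd and 3 ∤ K, the exponent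
-- does not change modulo 1 when h* is replaced by any other inverse of h modulo K: we take h′ for h
-- and h′/3 for 3h, both for K = k/2 and for k. The sign bits combine through (-K/3h) = (-K/3)(-K/h)
-- and (-2K/3) = -(-K/3). After these substitutions 576K times the difference of the two sides of each
-- identity is a polynomial identity, up to a multiple of 576K coming from h h′ ≡ -1 (mod 4k).
module Submission where

open import Defs
open import Data.Nat as ℕ using (ℕ)
open import Data.Nat.DivMod using (_/_)
open import Data.Nat.GCD using (gcd; gcd[m,n]∣m; gcd-greatest)
open import Data.Nat.Coprimality using (Coprime)
import Data.Nat.Coprimality as Coprime
open import Data.Integer as ℤ using (ℤ; +_; ∣_∣)
open import Data.Integer.Divisibility using (_∣_)
open import Data.Rational.Unnormalised as Q using (ℚᵘ)
open import Data.Rational.Unnormalised.Base using (mkℚᵘ; ↥_; ↧_; _≃_; *≡*)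
open import Data.Product using (_×_; _,_; ∃)
open import Data.List.Base using (_∷_; [])
open import Relation.Binary.PropositionalEquality using (_≡_)

open import Data.Bool using (true; false; T; if_then_else_)
open import Data.Unit using (tt)
open import Data.Empty using (⊥-elim)
open import Data.Nat.Base using (zero; suc; 2+; s≤s; z≤n; _≤_; _<_)
import Data.Nat.Properties as ℕₚ
import Data.Nat.DivMod as ℕD
open import Data.Nat.Divisibility as ℕ∣ using (_∣?_) renaming (_∣_ to _∣ℕ_)
open import Data.Nat.Primality using (Prime; prime?; prime[2]; euclidsLemma; prime⇒irreducible; ¬prime[0]; ¬prime[1])
open import Data.Integer.Base using (-[1+_]; _%ℕ_; _/ℕ_)
import Data.Integer.Properties as ℤₚ
open import Algebra.Properties.CommutativeSemigroup ℤₚ.*-commutativeSemigroup using (interchange; x∙yz≈y∙xz; xy∙z≈xz∙y)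
import Data.Integer.DivMod as ℤD
open import Data.Integer.Tactic.RingSolver using (solve; solve-∀)
import Data.Integer.Divisibility.Signed as ℤ∣
open import Data.Sum using (inj₁; inj₂)
open import Relation.Nullary using (¬_; yes; no; does; contradiction)
open import Relation.Nullary.Decidable using (dec-true; dec-false; toWitness; toWitnessFalse)
open import Function.Base using (_∘_)
open import Relation.Binary.PropositionalEquality using (refl; sym; trans; cong; cong₂; subst; _≢_; module ≡-Reasoning)

%ℕ≡0⇒∣ : ∀ a d .{{_ : ℕ.NonZero d}} → a %ℕ d ≡ 0 → + d ℤ∣.∣ a
%ℕ≡0⇒∣ a d r≡0 = ℤ∣.divides (a /ℕ d) (begin
  a                              ≡⟨ ℤD.a≡a%ℕn+[a/ℕn]*n a d ⟩
  + (a %ℕ d) ℤ.+ a /ℕ d ℤ.* + d  ≡⟨ cong (λ r → + r ℤ.+ a /ℕ d ℤ.* + d) r≡0 ⟩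
  + 0 ℤ.+ a /ℕ d ℤ.* + d         ≡⟨ ℤₚ.+-identityˡ _ ⟩
  a /ℕ d ℤ.* + d                 ∎)
  where open ≡-Reasoning

∣%ℕ⇒∣ : ∀ {q d} a .{{_ : ℕ.NonZero d}} → q ∣ℕ d → q ∣ℕ a %ℕ d → q ∣ℕ ∣ a ∣
∣%ℕ⇒∣ {q} {d} a q∣d q∣r = ℤ∣.∣⇒∣ᵤ (subst (+ q ℤ∣.∣_) (sym (ℤD.a≡a%ℕn+[a/ℕn]*n a d))
  (ℤ∣.∣m∣n⇒∣m+n (ℤ∣.∣ᵤ⇒∣ {+ q} {+ (a %ℕ d)} q∣r) (ℤ∣.∣n⇒∣m*n (a /ℕ d) (ℤ∣.∣ᵤ⇒∣ {+ q} {+ d} q∣d))))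

∣⇒%ℕ≡0 : ∀ a d .{{_ : ℕ.NonZero d}} → d ∣ℕ ∣ a ∣ → a %ℕ d ≡ 0
∣⇒%ℕ≡0 (+ n)    d d∣a = ℕ∣.n∣m⇒m%n≡0 n d d∣a
∣⇒%ℕ≡0 -[1+ n ] d d∣a rewrite ℕ∣.n∣m⇒m%n≡0 (suc n) d d∣a = refl

-- p-adic valuations

valF-∣ : ∀ {p f m} → 2+ p ∣ℕ suc m → valF (suc f) (2+ p) (suc m) ≡ suc (valF f (2+ p) (suc m / 2+ p))
valF-∣ {p} {f} {m} p∣m = cong (λ b → if b then suc (valF f (2+ p) (suc m / 2+ p)) else 0) (dec-true (2+ p ∣? suc m) p∣m)

valF-∤ : ∀ {p} f n → ¬ 2+ p ∣ℕ n → valF f (2+ p) n ≡ 0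
valF-∤ zero    n       _   = refl
valF-∤ (suc f) zero    p∤n = contradiction (ℕ∣._∣0 _) p∤n
valF-∤ {p} (suc f) (suc m) p∤n = cong (λ b → if b then suc (valF f (2+ p) (suc m / 2+ p)) else 0) (dec-false (2+ p ∣? suc m) p∤n)

valF-zero : ∀ {p} f → valF f (2+ p) 0 ≡ 0
valF-zero zero    = refl
valF-zero (suc f) = refl

[1+m]/p<1+m : ∀ {p} m → suc m / 2+ p < suc m
[1+m]/p<1+m {p} m = ℕD.m/n<m (suc m) (2+ p) (s≤s (s≤s z≤n))

valF-fuel : ∀ {p f f′} n → n ≤ f → n ≤ f′ → valF f (2+ p) n ≡ valF f′ (2+ p) n
valF-fuel {f = f} {f′} zero _ _ = trans (valF-zero f) (sym (valF-zero f′))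
valF-fuel {p} {suc f} {suc f′} (suc m) (s≤s m≤f) (s≤s m≤f′) with 2+ p ∣? suc m
... | yes p∣m = begin
  valF (suc f) (2+ p) (suc m)          ≡⟨ valF-∣ {f = f} p∣m ⟩
  suc (valF f (2+ p) (suc m / 2+ p))   ≡⟨ cong suc (valF-fuel _ (bound m≤f) (bound m≤f′)) ⟩
  suc (valF f′ (2+ p) (suc m / 2+ p))  ≡⟨ valF-∣ {f = f′} p∣m ⟨
  valF (suc f′) (2+ p) (suc m)         ∎
  where
  open ≡-Reasoning
  bound : ∀ {g} → m ≤ g → suc m / 2+ p ≤ g
  bound m≤g = ℕₚ.≤-trans (ℕₚ.≤-pred ([1+m]/p<1+m m)) m≤g
... | no p∤m = trans (valF-∤ (suc f) (suc m) p∤m) (sym (valF-∤ (suc f′) (suc m) p∤m))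

val-∣ : ∀ {p m} → 2+ p ∣ℕ suc m → val (2+ p) (suc m) ≡ suc (val (2+ p) (suc m / 2+ p))
val-∣ {p} {m} p∣m = trans (valF-∣ {f = m} p∣m)
  (cong suc (valF-fuel _ (ℕₚ.≤-pred ([1+m]/p<1+m m)) ℕₚ.≤-refl))

val-∤ : ∀ {p} n → ¬ 2+ p ∣ℕ n → val (2+ p) n ≡ 0
val-∤ n = valF-∤ n n

val-*-self : ∀ p m → val (2+ p) (2+ p ℕ.* suc m) ≡ suc (val (2+ p) (suc m))
val-*-self p m = trans (val-∣ (ℕ∣.m∣m*n (suc m)))
  (cong (λ n → suc (val (2+ p) n)) (trans (cong (_/ 2+ p) (ℕₚ.*-comm (2+ p) (suc m))) (ℕD.m*n/n≡m (suc m) (2+ p))))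

valF-*-∤ : ∀ {q p} f n → Prime (2+ q) → ¬ 2+ q ∣ℕ suc p → suc p ℕ.* n ≤ f →
           valF f (2+ q) (suc p ℕ.* n) ≡ valF f (2+ q) n
valF-*-∤ {q} {p} f zero _ _ _ rewrite ℕₚ.*-zeroʳ p = refl
valF-*-∤ {q} {p} (suc f) (suc m) q-prime q∤p (s≤s pm≤f) with 2+ q ∣? suc m
... | yes q∣m = begin
  valF (suc f) (2+ q) (suc p ℕ.* suc m)          ≡⟨ valF-∣ {f = f} (ℕ∣.∣n⇒∣m*n (suc p) q∣m) ⟩
  suc (valF f (2+ q) (suc p ℕ.* suc m / 2+ q))   ≡⟨ cong (λ n → suc (valF f (2+ q) n)) (ℕD.*-/-assoc (suc p) q∣m) ⟩
  suc (valF f (2+ q) (suc p ℕ.* (suc m / 2+ q))) ≡⟨ cong suc (valF-*-∤ f _ q-prime q∤p bound) ⟩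
  suc (valF f (2+ q) (suc m / 2+ q))             ≡⟨ valF-∣ {f = f} q∣m ⟨
  valF (suc f) (2+ q) (suc m)                    ∎
  where
  open ≡-Reasoning
  bound : suc p ℕ.* (suc m / 2+ q) ≤ f
  bound = ℕₚ.≤-pred (ℕₚ.≤-trans (ℕₚ.*-monoʳ-< (suc p) ([1+m]/p<1+m m)) (s≤s pm≤f))
... | no q∤m = trans (valF-∤ (suc f) _ q∤pm) (sym (valF-∤ (suc f) (suc m) q∤m))
  where
  q∤pm : ¬ 2+ q ∣ℕ suc p ℕ.* suc m
  q∤pm q∣pm with euclidsLemma (suc p) (suc m) q-prime q∣pm
  ... | inj₁ q∣p = q∤p q∣p
  ... | inj₂ q∣m = q∤m q∣m

val-*-∤ : ∀ {q p} n → Prime (2+ q) → ¬ 2+ q ∣ℕ suc p → val (2+ q) (suc p ℕ.* n) ≡ val (2+ q) n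
val-*-∤ {q} {p} n q-prime q∤p = trans (valF-*-∤ _ n q-prime q∤p ℕₚ.≤-refl)
  (valF-fuel n (ℕₚ.m≤n*m n (suc p)) ℕₚ.≤-refl)

val-self : ∀ p → val (2+ p) (2+ p) ≡ 1
val-self p = begin
  val (2+ p) (2+ p)                  ≡⟨ cong (val (2+ p)) (ℕₚ.*-identityʳ (2+ p)) ⟨
  val (2+ p) (2+ p ℕ.* 1)            ≡⟨ val-*-self p 0 ⟩
  suc (val (2+ p) 1)                 ≡⟨ cong suc (val-∤ 1 (λ q∣1 → contradiction (ℕ∣.∣1⇒≡1 {2+ p} q∣1) λ ())) ⟩
  1                                  ∎
  where open ≡-Reasoning

prime-∤-prime : ∀ {p q} → Prime p → Prime q → q ≢ p → ¬ q ∣ℕ p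
prime-∤-prime p-prime q-prime q≢p q∣p with prime⇒irreducible p-prime q∣p
... | inj₁ refl = ¬prime[1] q-prime
... | inj₂ q≡p  = q≢p q≡p

val-*-prime : ∀ {p q} m → Prime (2+ p) → Prime (2+ q) →
              val (2+ q) (2+ p ℕ.* suc m) ≡ val (2+ q) (suc m) ℕ.+ val (2+ q) (2+ p)
val-*-prime {p} {q} m p-prime q-prime with q ℕ.≟ p
... | yes refl = begin
  val (2+ p) (2+ p ℕ.* suc m)   ≡⟨ val-*-self p m ⟩
  suc (val (2+ p) (suc m))      ≡⟨ ℕₚ.+-comm 1 _ ⟩
  val (2+ p) (suc m) ℕ.+ 1      ≡⟨ cong (val (2+ p) (suc m) ℕ.+_) (val-self p) ⟨
  val (2+ p) (suc m) ℕ.+ val (2+ p) (2+ p) ∎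
  where open ≡-Reasoning
... | no q≢p = begin
  val (2+ q) (2+ p ℕ.* suc m)   ≡⟨ val-*-∤ (suc m) q-prime q∤p ⟩
  val (2+ q) (suc m)            ≡⟨ ℕₚ.+-identityʳ _ ⟨
  val (2+ q) (suc m) ℕ.+ 0      ≡⟨ cong (val (2+ q) (suc m) ℕ.+_) (val-∤ (2+ p) q∤p) ⟨
  val (2+ q) (suc m) ℕ.+ val (2+ q) (2+ p) ∎
  where
  open ≡-Reasoning
  q∤p : ¬ 2+ q ∣ℕ 2+ p
  q∤p = prime-∤-prime p-prime q-prime (λ { refl → q≢p refl })

-- The Kronecker symbol

-- kronProd a m (suc q) unfolds to kronProd a m q ℤ.* kronFactor a m (suc q).
kronFactor : ℤ → ℕ → ℕ → ℤ
kronFactor a m q = if does (prime? q) then kronPrime a q ℤ.^ val q m else + 1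

kronFactor-prime : ∀ a m {q} → Prime q → kronFactor a m q ≡ kronPrime a q ℤ.^ val q m
kronFactor-prime a m {q} q-prime = cong (λ b → if b then kronPrime a q ℤ.^ val q m else + 1) (dec-true (prime? q) q-prime)

kronFactor-nonprime : ∀ a m {q} → ¬ Prime q → kronFactor a m q ≡ + 1
kronFactor-nonprime a m {q} ¬q-prime = cong (λ b → if b then kronPrime a q ℤ.^ val q m else + 1) (dec-false (prime? q) ¬q-prime)

kronFactor-*-prime : ∀ {p} a m q → Prime p →
                     kronFactor a (p ℕ.* suc m) q ≡ kronFactor a (suc m) q ℤ.* kronFactor a p q
kronFactor-*-prime a m q p-prime with prime? q
... | no _ = refl
kronFactor-*-prime {2+ p} a m (2+ q) p-prime | yes q-prime =
  trans (cong (kronPrime a (2+ q) ℤ.^_) (val-*-prime m p-prime q-prime))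
        (ℤₚ.^-distribˡ-+-* (kronPrime a (2+ q)) (val (2+ q) (suc m)) (val (2+ q) (2+ p)))
kronFactor-*-prime {0} _ _ _ p-prime | yes _ = contradiction p-prime ¬prime[0]
kronFactor-*-prime {1} _ _ _ p-prime | yes _ = contradiction p-prime ¬prime[1]
kronFactor-*-prime {2+ _} _ _ 0 _ | yes q-prime = contradiction q-prime ¬prime[0]
kronFactor-*-prime {2+ _} _ _ 1 _ | yes q-prime = contradiction q-prime ¬prime[1]

kronProd-*-prime : ∀ {p} a m N → Prime p → kronProd a (p ℕ.* suc m) N ≡ kronProd a (suc m) N ℤ.* kronProd a p N
kronProd-*-prime a m zero    p-prime = refl
kronProd-*-prime {p} a m (suc N) p-prime =
  trans (cong₂ ℤ._*_ (kronProd-*-prime a m N p-prime) (kronFactor-*-prime a m (suc N) p-prime))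
        (interchange (kronProd a (suc m) N) (kronProd a p N) (kronFactor a (suc m) (suc N)) (kronFactor a p (suc N)))

kronFactor-beyond : ∀ a m q → suc m < q → kronFactor a (suc m) q ≡ + 1
kronFactor-beyond a m (2+ q) m<q with prime? (2+ q)
... | yes q-prime = trans (kronFactor-prime a (suc m) q-prime) (cong (kronPrime a (2+ q) ℤ.^_) (val-∤ (suc m) (ℕ∣.>⇒∤ m<q)))
... | no ¬q-prime = kronFactor-nonprime a (suc m) ¬q-prime
kronFactor-beyond a m 1 (s≤s ())

kronProd-stable : ∀ a m N → suc m ≤ N → kronProd a (suc m) N ≡ kronNat a (suc m)
kronProd-stable a m N m<N = trans (cong (kronProd a (suc m)) (sym (ℕₚ.m+[n∸m]≡n m<N))) (beyond (N ℕ.∸ suc m))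
  where
  beyond : ∀ d → kronProd a (suc m) (suc m ℕ.+ d) ≡ kronNat a (suc m)
  beyond zero    = cong (kronProd a (suc m)) (ℕₚ.+-identityʳ (suc m))
  beyond (suc d) = begin
    kronProd a (suc m) (suc m ℕ.+ suc d)                                 ≡⟨ cong (kronProd a (suc m)) (ℕₚ.+-suc (suc m) d) ⟩
    kronProd a (suc m) (suc m ℕ.+ d) ℤ.* kronFactor a (suc m) (2+ (m ℕ.+ d)) ≡⟨ cong₂ ℤ._*_ (beyond d) (kronFactor-beyond a m _ (s≤s (s≤s (ℕₚ.m≤m+n m d)))) ⟩
    kronNat a (suc m) ℤ.* + 1                                              ≡⟨ ℤₚ.*-identityʳ _ ⟩
    kronNat a (suc m)                                                      ∎
    where open ≡-Reasoning

kronNat-*-prime : ∀ {p} a m → Prime p → kronNat a (p ℕ.* suc m) ≡ kronNat a p ℤ.* kronNat a (suc m)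
kronNat-*-prime {2+ p} a m p-prime = let N = 2+ p ℕ.* suc m in begin
  kronProd a (2+ p ℕ.* suc m) (2+ p ℕ.* suc m)                       ≡⟨ kronProd-*-prime a m N p-prime ⟩
  kronProd a (suc m) (2+ p ℕ.* suc m) ℤ.* kronProd a (2+ p) (2+ p ℕ.* suc m)
    ≡⟨ cong₂ ℤ._*_ (kronProd-stable a m N (ℕₚ.m≤n*m (suc m) (2+ p))) (kronProd-stable a (suc p) N (ℕₚ.m≤m*n (2+ p) (suc m))) ⟩
  kronNat a (suc m) ℤ.* kronNat a (2+ p)                              ≡⟨ ℤₚ.*-comm (kronNat a (suc m)) (kronNat a (2+ p)) ⟩
  kronNat a (2+ p) ℤ.* kronNat a (suc m)                              ∎
  where open ≡-Reasoning
kronNat-*-prime {0} _ _ p-prime = contradiction p-prime ¬prime[0]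
kronNat-*-prime {1} _ _ p-prime = contradiction p-prime ¬prime[1]

kronecker-*-prime : ∀ {p} a h → Prime p → h ≢ + 0 → kronecker a (+ p ℤ.* h) ≡ kronNat a p ℤ.* kronecker a h
kronecker-*-prime {2+ p} a (+ zero) _ h≢0 = contradiction refl h≢0
kronecker-*-prime {2+ p} a (+ suc n) p-prime _ = kronNat-*-prime a n p-prime
kronecker-*-prime {2+ p} a@(+ _) -[1+ n ] p-prime _ =
  trans (cong (+ 1 ℤ.*_) (kronNat-*-prime a n p-prime)) (x∙yz≈y∙xz (+ 1) (kronNat a (2+ p)) (kronNat a (suc n)))
kronecker-*-prime {2+ p} a@(-[1+ _ ]) -[1+ n ] p-prime _ =
  trans (cong (-[1+ 0 ] ℤ.*_) (kronNat-*-prime a n p-prime)) (x∙yz≈y∙xz -[1+ 0 ] (kronNat a (2+ p)) (kronNat a (suc n)))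
kronecker-*-prime {0} _ _ p-prime _ = contradiction p-prime ¬prime[0]
kronecker-*-prime {1} _ _ p-prime _ = contradiction p-prime ¬prime[1]

*-≢0 : ∀ {i j} → i ≢ + 0 → j ≢ + 0 → i ℤ.* j ≢ + 0
*-≢0 {i} i≢0 j≢0 ij≡0 with ℤₚ.i*j≡0⇒i≡0∨j≡0 i ij≡0
... | inj₁ i≡0 = i≢0 i≡0
... | inj₂ j≡0 = j≢0 j≡0

^-≢0 : ∀ {i} n → i ≢ + 0 → i ℤ.^ n ≢ + 0
^-≢0 zero    _   ()
^-≢0 (suc n) i≢0 = *-≢0 i≢0 (^-≢0 n i≢0)

prime∣^⇒∣ : ∀ {p m} n → Prime p → p ∣ℕ m ℕ.^ n → p ∣ℕ m
prime∣^⇒∣ zero    p-prime p∣1 = contradiction (subst Prime (ℕ∣.∣1⇒≡1 p∣1) p-prime) ¬prime[1]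
prime∣^⇒∣ {m = m} (suc n) p-prime p∣mmⁿ with euclidsLemma m (m ℕ.^ n) p-prime p∣mmⁿ
... | inj₁ p∣m  = p∣m
... | inj₂ p∣mⁿ = prime∣^⇒∣ n p-prime p∣mⁿ

kron2≡0⇒2∣%8 : ∀ a → kron2 a ≡ + 0 → 2 ∣ℕ a %ℕ 8
kron2≡0⇒2∣%8 a with a %ℕ 8 | ℤD.n%ℕd<d a 8
... | 0 | _ = λ _ → ℕ∣.divides 0 refl
... | 2 | _ = λ _ → ℕ∣.divides 1 refl
... | 4 | _ = λ _ → ℕ∣.divides 2 refl
... | 6 | _ = λ _ → ℕ∣.divides 3 refl
... | 1 | _ = λ ()
... | 3 | _ = λ ()
... | 5 | _ = λ ()
... | 7 | _ = λ ()
... | 2+ (2+ (2+ (2+ _))) | s≤s (s≤s (s≤s (s≤s (s≤s (s≤s (s≤s (s≤s ()))))))) 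

legendre≡0⇒∣ : ∀ a p → Prime (suc p) → legendre a (suc p) ≡ + 0 → suc p ∣ℕ ∣ a ∣
legendre≡0⇒∣ a p p-prime with (a %ℕ suc p) ℕ.^ ℕ.⌊ p /2⌋ ℕ.% suc p in r≡0
... | 0 = λ _ → ∣%ℕ⇒∣ a ℕ∣.∣-refl (prime∣^⇒∣ ℕ.⌊ p /2⌋ p-prime (ℕ∣.m%n≡0⇒n∣m _ (suc p) r≡0))
... | 1 = λ ()
... | 2+ _ = λ ()

kronPrime≡0⇒∣ : ∀ a {q} → Prime q → kronPrime a q ≡ + 0 → q ∣ℕ ∣ a ∣
kronPrime≡0⇒∣ a {2} _ κ≡0 = ∣%ℕ⇒∣ a (ℕ∣.divides 4 refl) (kron2≡0⇒2∣%8 a κ≡0)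
kronPrime≡0⇒∣ a {suc (2+ p)} q-prime κ≡0 = legendre≡0⇒∣ a (2+ p) q-prime κ≡0
kronPrime≡0⇒∣ a {0} q-prime = contradiction q-prime ¬prime[0]
kronPrime≡0⇒∣ a {1} q-prime = contradiction q-prime ¬prime[1]

kronFactor-≢0 : ∀ a m q → Coprime ∣ a ∣ (suc m) → kronFactor a (suc m) q ≢ + 0
kronFactor-≢0 a m q coprime with prime? q
... | no _        = λ ()
... | yes q-prime = power≢0 q q-prime
  where
  power≢0 : ∀ q → Prime q → kronPrime a q ℤ.^ val q (suc m) ≢ + 0
  power≢0 (2+ q) q-prime with 2+ q ∣? suc m
  ... | yes q∣m = ^-≢0 (val (2+ q) (suc m)) λ κ≡0 → ¬prime[1] (subst Prime (coprime (kronPrime≡0⇒∣ a q-prime κ≡0 , q∣m)) q-prime)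
  ... | no  q∤m = subst (λ v → kronPrime a (2+ q) ℤ.^ v ≢ + 0) (sym (val-∤ (suc m) q∤m)) λ ()
  power≢0 0 q-prime = contradiction q-prime ¬prime[0]
  power≢0 1 q-prime = contradiction q-prime ¬prime[1]

kronProd-≢0 : ∀ a m N → Coprime ∣ a ∣ (suc m) → kronProd a (suc m) N ≢ + 0
kronProd-≢0 a m zero    _       = λ ()
kronProd-≢0 a m (suc N) coprime = *-≢0 (kronProd-≢0 a m N coprime) (kronFactor-≢0 a m (suc N) coprime)

kronecker-≢0 : ∀ a h → Coprime ∣ a ∣ ∣ h ∣ → kronecker a h ≢ + 0
kronecker-≢0 a (+ zero) coprime rewrite Coprime.0-coprimeTo-m⇒m≡1 (Coprime.sym coprime) = λ ()
kronecker-≢0 a (+ suc n) coprime = kronProd-≢0 a n (suc n) coprime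
kronecker-≢0 a@(+ _) -[1+ n ] coprime = *-≢0 {+ 1} (λ ()) (kronProd-≢0 a n (suc n) coprime)
kronecker-≢0 a@(-[1+ _ ]) -[1+ n ] coprime = *-≢0 { -[1+ 0 ]} (λ ()) (kronProd-≢0 a n (suc n) coprime)

kronNat-3-≡1 : ∀ a → a %ℕ 3 ≡ 1 → kronNat a 3 ≡ + 1
kronNat-3-≡1 a a≡1 rewrite a≡1 = refl

kronNat-3-≡2 : ∀ a → a %ℕ 3 ≡ 2 → kronNat a 3 ≡ -[1+ 0 ]
kronNat-3-≡2 a a≡2 rewrite a≡2 = refl

neg-%ℕ : ∀ {r} n d .{{_ : ℕ.NonZero d}} → n ℕ.% d ≡ suc r → (ℤ.- + n) %ℕ d ≡ d ℕ.∸ suc r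
neg-%ℕ zero    (suc d) ()
neg-%ℕ (suc n) d n≡r rewrite n≡r = refl

%3-double : ∀ {K r} → K ℕ.% 3 ≡ r → (2 ℕ.* K) ℕ.% 3 ≡ (2 ℕ.* r) ℕ.% 3
%3-double {K} K≡r = trans (ℕD.%-distribˡ-* 2 K 3) (cong (λ r → (2 ℕ.* r) ℕ.% 3) K≡r)

kronNat-3-neg-double : ∀ K → ¬ 3 ∣ℕ K → kronNat (ℤ.- + (2 ℕ.* K)) 3 ≡ ℤ.- kronNat (ℤ.- + K) 3
kronNat-3-neg-double K 3∤K with K ℕ.% 3 in K≡r | ℕD.m%n<n K 3
... | 0 | _ = contradiction (ℕ∣.m%n≡0⇒n∣m K 3 K≡r) 3∤K
... | 1 | _ = trans (kronNat-3-≡1 (ℤ.- + (2 ℕ.* K)) (neg-%ℕ (2 ℕ.* K) 3 (%3-double {K} K≡r)))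
                    (cong ℤ.-_ (sym (kronNat-3-≡2 (ℤ.- + K) (neg-%ℕ K 3 K≡r))))
... | 2 | _ = trans (kronNat-3-≡2 (ℤ.- + (2 ℕ.* K)) (neg-%ℕ (2 ℕ.* K) 3 (%3-double {K} K≡r)))
                    (cong ℤ.-_ (sym (kronNat-3-≡1 (ℤ.- + K) (neg-%ℕ K 3 K≡r))))
... | 2+ (suc _) | s≤s (s≤s (s≤s ()))

odd⇒%ℕ2≡1 : ∀ h → ¬ 2 ∣ℕ ∣ h ∣ → h %ℕ 2 ≡ 1
odd⇒%ℕ2≡1 h h-odd with h %ℕ 2 in r≡ | ℤD.n%ℕd<d h 2
... | 0    | _ = contradiction (∣%ℕ⇒∣ h ℕ∣.∣-refl (subst (2 ∣ℕ_) (sym r≡) (ℕ∣._∣0 2))) h-odd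
... | 1    | _ = refl
... | 2+ _ | s≤s (s≤s ())

isOdd-true : ∀ h → ¬ 2 ∣ℕ ∣ h ∣ → isOdd h ≡ true
isOdd-true h h-odd = cong (ℕ._≡ᵇ 1) (odd⇒%ℕ2≡1 h h-odd)

odd-* : ∀ i j → ¬ 2 ∣ℕ ∣ i ∣ → ¬ 2 ∣ℕ ∣ j ∣ → ¬ 2 ∣ℕ ∣ i ℤ.* j ∣
odd-* i j i-odd j-odd 2∣ij with euclidsLemma ∣ i ∣ ∣ j ∣ prime[2] (subst (2 ∣ℕ_) (ℤₚ.abs-* i j) 2∣ij)
... | inj₁ 2∣i = i-odd 2∣i
... | inj₂ 2∣j = j-odd 2∣j

pronic-even : ∀ q → ∃ λ t → q ℤ.* (q ℤ.+ + 1) ≡ + 2 ℤ.* t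
pronic-even q = split (q %ℕ 2) (q /ℕ 2) (ℤD.n%ℕd<d q 2) (ℤD.a≡a%ℕn+[a/ℕn]*n q 2)
  where
  split : ∀ {q} r q′ → r < 2 → q ≡ + r ℤ.+ q′ ℤ.* + 2 → ∃ λ t → q ℤ.* (q ℤ.+ + 1) ≡ + 2 ℤ.* t
  split 0 q′ _ refl = q′ ℤ.* (+ 2 ℤ.* q′ ℤ.+ + 1) , solve (q′ ∷ [])
  split 1 q′ _ refl = (+ 1 ℤ.+ + 2 ℤ.* q′) ℤ.* (+ 1 ℤ.+ q′) , solve (q′ ∷ [])
  split (2+ _) _ (s≤s (s≤s ())) _

odd-square : ∀ h → ¬ 2 ∣ℕ ∣ h ∣ → ∃ λ α → h ℤ.* h ≡ + 1 ℤ.+ + 8 ℤ.* α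
odd-square h h-odd = square (h /ℕ 2) h≡1+2q
  where
  h≡1+2q : h ≡ + 1 ℤ.+ h /ℕ 2 ℤ.* + 2
  h≡1+2q = trans (ℤD.a≡a%ℕn+[a/ℕn]*n h 2) (cong (λ r → + r ℤ.+ h /ℕ 2 ℤ.* + 2) (odd⇒%ℕ2≡1 h h-odd))
  square : ∀ {h} q → h ≡ + 1 ℤ.+ q ℤ.* + 2 → ∃ λ α → h ℤ.* h ≡ + 1 ℤ.+ + 8 ℤ.* α
  square q refl with pronic-even q
  ... | t , q[q+1]≡2t = t , (begin
    (+ 1 ℤ.+ q ℤ.* + 2) ℤ.* (+ 1 ℤ.+ q ℤ.* + 2) ≡⟨ solve (q ∷ []) ⟩
    + 1 ℤ.+ + 4 ℤ.* (q ℤ.* (q ℤ.+ + 1))         ≡⟨ cong (λ x → + 1 ℤ.+ + 4 ℤ.* x) q[q+1]≡2t ⟩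
    + 1 ℤ.+ + 4 ℤ.* (+ 2 ℤ.* t)                 ≡⟨ solve (t ∷ []) ⟩
    + 1 ℤ.+ + 8 ℤ.* t                           ∎)
    where open ≡-Reasoning

square-prime-to-3 : ∀ K → ¬ 3 ∣ℕ K → ∃ λ β → + K ℤ.* + K ≡ + 1 ℤ.+ + 3 ℤ.* β
square-prime-to-3 K 3∤K = split (K ℕ.% 3) (+ K /ℕ 3) (ℕ∣.m%n≡0⇒n∣m K 3) (ℕD.m%n<n K 3) (ℤD.a≡a%ℕn+[a/ℕn]*n (+ K) 3)
  where
  split : ∀ r q → (r ≡ 0 → 3 ∣ℕ K) → r < 3 → + K ≡ + r ℤ.+ q ℤ.* + 3 → ∃ λ β → + K ℤ.* + K ≡ + 1 ℤ.+ + 3 ℤ.* β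
  split 0 _ 3∣K _ _ = contradiction (3∣K refl) 3∤K
  split 1 q _ _ K≡ = q ℤ.* (+ 2 ℤ.+ + 3 ℤ.* q) , (begin
    + K ℤ.* + K                                   ≡⟨ cong₂ ℤ._*_ K≡ K≡ ⟩
    (+ 1 ℤ.+ q ℤ.* + 3) ℤ.* (+ 1 ℤ.+ q ℤ.* + 3)   ≡⟨ solve (q ∷ []) ⟩
    + 1 ℤ.+ + 3 ℤ.* (q ℤ.* (+ 2 ℤ.+ + 3 ℤ.* q))   ∎)
    where open ≡-Reasoning
  split 2 q _ _ K≡ = + 1 ℤ.+ q ℤ.* (+ 4 ℤ.+ + 3 ℤ.* q) , (begin
    + K ℤ.* + K                                           ≡⟨ cong₂ ℤ._*_ K≡ K≡ ⟩
    (+ 2 ℤ.+ q ℤ.* + 3) ℤ.* (+ 2 ℤ.+ q ℤ.* + 3)           ≡⟨ solve (q ∷ []) ⟩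
    + 1 ℤ.+ + 3 ℤ.* (+ 1 ℤ.+ q ℤ.* (+ 4 ℤ.+ + 3 ℤ.* q))   ∎)
    where open ≡-Reasoning
  split (2+ (suc _)) _ _ (s≤s (s≤s (s≤s ()))) _

-- searchStar h (suc K) n tries the candidates K + 1 - n, ..., K in increasing order.
searchStar-finds : ∀ h K n c → n ≤ suc K → suc K ℕ.∸ n ≤ c → c < suc K →
                   (h ℤ.* + c ℤ.+ + 1) %ℕ suc K ≡ 0 →
                   (h ℤ.* + searchStar h (suc K) n ℤ.+ + 1) %ℕ suc K ≡ 0
searchStar-finds h K zero c _ K≤c c<K _ = contradiction (ℕₚ.≤-<-trans K≤c c<K) (ℕₚ.<-irrefl refl)
searchStar-finds h K (suc n) c (s≤s n≤K) K-n≤c c<K c-inverts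
  with (h ℤ.* + (K ℕ.∸ n) ℤ.+ + 1) %ℕ suc K ℕ.≡ᵇ 0 in found
... | true  = ℕₚ.≡ᵇ⇒≡ _ 0 (subst T (sym found) tt)
... | false = searchStar-finds h K n c (ℕₚ.m≤n⇒m≤1+n n≤K) K-n<c c<K c-inverts
  where
  K-n<c : suc K ℕ.∸ n ≤ c
  K-n<c with ℕₚ.m≤n⇒m<n∨m≡n K-n≤c
  ... | inj₁ K-n<c = subst (_≤ c) (sym (ℕₚ.+-∸-assoc 1 n≤K)) K-n<c
  ... | inj₂ refl  = ⊥-elim (subst T found (ℕₚ.≡⇒≡ᵇ _ 0 c-inverts))

hStar-inverse : ∀ h K x .{{_ : ℕ.NonZero K}} → + K ℤ∣.∣ h ℤ.* x ℤ.+ + 1 → + K ℤ∣.∣ h ℤ.* hStar h K ℤ.+ + 1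
hStar-inverse h (suc K) x K∣hx+1 = %ℕ≡0⇒∣ _ (suc K)
  (searchStar-finds h K (suc K) c ℕₚ.≤-refl (subst (_≤ c) (sym (ℕₚ.n∸n≡0 (suc K))) z≤n) (ℤD.n%ℕd<d x (suc K))
    (∣⇒%ℕ≡0 (h ℤ.* + c ℤ.+ + 1) (suc K) (ℤ∣.∣⇒∣ᵤ K∣hc+1)))
  where
  c : ℕ
  c = x %ℕ suc K
  q : ℤ
  q = x /ℕ suc K
  hc+1≡ : h ℤ.* + c ℤ.+ + 1 ≡ (h ℤ.* x ℤ.+ + 1) ℤ.- (h ℤ.* q) ℤ.* + suc K
  hc+1≡ = begin
    h ℤ.* + c ℤ.+ + 1                                        ≡⟨ ring h (+ c) q (+ suc K) ⟩
    (h ℤ.* (+ c ℤ.+ q ℤ.* + suc K) ℤ.+ + 1) ℤ.- (h ℤ.* q) ℤ.* + suc K ≡⟨ cong (λ y → (h ℤ.* y ℤ.+ + 1) ℤ.- (h ℤ.* q) ℤ.* + suc K) (ℤD.a≡a%ℕn+[a/ℕn]*n x (suc K)) ⟨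
    (h ℤ.* x ℤ.+ + 1) ℤ.- (h ℤ.* q) ℤ.* + suc K               ∎
    where
    open ≡-Reasoning
    ring : ∀ h c q K → h ℤ.* c ℤ.+ + 1 ≡ (h ℤ.* (c ℤ.+ q ℤ.* K) ℤ.+ + 1) ℤ.- (h ℤ.* q) ℤ.* K
    ring = solve-∀
  K∣hc+1 : + suc K ℤ∣.∣ h ℤ.* + c ℤ.+ + 1
  K∣hc+1 = subst (+ suc K ℤ∣.∣_) (sym hc+1≡) (ℤ∣.∣m∣n⇒∣m-n K∣hx+1 (ℤ∣.∣n⇒∣m*n (h ℤ.* q) ℤ∣.∣-refl))

inverses-congruent : ∀ {M h s x} → M ℤ∣.∣ h ℤ.* s ℤ.+ + 1 → M ℤ∣.∣ h ℤ.* x ℤ.+ + 1 → ∃ λ t → s ≡ x ℤ.+ M ℤ.* t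
inverses-congruent {M} {h} {s} {x} (ℤ∣.divides a hs+1≡aM) (ℤ∣.divides b hx+1≡bM) = s ℤ.* b ℤ.- x ℤ.* a , (begin
  s                                                           ≡⟨ solve (h ∷ s ∷ x ∷ []) ⟩
  x ℤ.+ (s ℤ.* (h ℤ.* x ℤ.+ + 1) ℤ.- x ℤ.* (h ℤ.* s ℤ.+ + 1)) ≡⟨ cong₂ (λ u v → x ℤ.+ (s ℤ.* u ℤ.- x ℤ.* v)) hx+1≡bM hs+1≡aM ⟩
  x ℤ.+ (s ℤ.* (b ℤ.* M) ℤ.- x ℤ.* (a ℤ.* M))                 ≡⟨ solve (x ∷ s ∷ a ∷ b ∷ M ∷ []) ⟩
  x ℤ.+ M ℤ.* (s ℤ.* b ℤ.- x ℤ.* a)                           ∎)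
  where open ≡-Reasoning

-- Rationals as quotients of integers

infix 4 _≐_÷_

record _≐_÷_ (p : ℚᵘ) (a b : ℤ) : Set where
  constructor mk≐
  field
    denominator≢0 : b ≢ + 0
    cross-≡       : ↥ p ℤ.* b ≡ a ℤ.* ↧ p

frac-≐ : ∀ n d .{{_ : ℕ.NonZero d}} → frac n d ≐ n ÷ + d
frac-≐ n (suc d) = mk≐ (λ ()) refl

≐-+ : ∀ {p q a b c d} → p ≐ a ÷ b → q ≐ c ÷ d → p Q.+ q ≐ (a ℤ.* d ℤ.+ c ℤ.* b) ÷ (b ℤ.* d)
≐-+ {mkℚᵘ m k} {mkℚᵘ n l} {a} {b} {c} {d} (mk≐ b≢0 mb≡aK) (mk≐ d≢0 nd≡cL) = mk≐ (*-≢0 b≢0 d≢0) (begin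
  (m ℤ.* L ℤ.+ n ℤ.* K) ℤ.* (b ℤ.* d)                 ≡⟨ ring₁ m n K L b d ⟩
  (m ℤ.* b) ℤ.* (L ℤ.* d) ℤ.+ (n ℤ.* d) ℤ.* (K ℤ.* b) ≡⟨ cong₂ (λ x y → x ℤ.* (L ℤ.* d) ℤ.+ y ℤ.* (K ℤ.* b)) mb≡aK nd≡cL ⟩
  (a ℤ.* K) ℤ.* (L ℤ.* d) ℤ.+ (c ℤ.* L) ℤ.* (K ℤ.* b) ≡⟨ ring₂ a c K L b d ⟩
  (a ℤ.* d ℤ.+ c ℤ.* b) ℤ.* (K ℤ.* L)                 ≡⟨ cong ((a ℤ.* d ℤ.+ c ℤ.* b) ℤ.*_) (ℤₚ.pos-* (suc k) (suc l)) ⟨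
  (a ℤ.* d ℤ.+ c ℤ.* b) ℤ.* + (suc k ℕ.* suc l)       ∎)
  where
  open ≡-Reasoning
  K L : ℤ
  K = + suc k
  L = + suc l
  ring₁ : ∀ m n K L b d → (m ℤ.* L ℤ.+ n ℤ.* K) ℤ.* (b ℤ.* d) ≡ (m ℤ.* b) ℤ.* (L ℤ.* d) ℤ.+ (n ℤ.* d) ℤ.* (K ℤ.* b)
  ring₁ = solve-∀
  ring₂ : ∀ a c K L b d → (a ℤ.* K) ℤ.* (L ℤ.* d) ℤ.+ (c ℤ.* L) ℤ.* (K ℤ.* b) ≡ (a ℤ.* d ℤ.+ c ℤ.* b) ℤ.* (K ℤ.* L)
  ring₂ = solve-∀

≐-* : ∀ {p q a b c d} → p ≐ a ÷ b → q ≐ c ÷ d → p Q.* q ≐ (a ℤ.* c) ÷ (b ℤ.* d)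
≐-* {mkℚᵘ m k} {mkℚᵘ n l} {a} {b} {c} {d} (mk≐ b≢0 mb≡aK) (mk≐ d≢0 nd≡cL) = mk≐ (*-≢0 b≢0 d≢0) (begin
  (m ℤ.* n) ℤ.* (b ℤ.* d)       ≡⟨ interchange m n b d ⟩
  (m ℤ.* b) ℤ.* (n ℤ.* d)       ≡⟨ cong₂ ℤ._*_ mb≡aK nd≡cL ⟩
  (a ℤ.* K) ℤ.* (c ℤ.* L)       ≡⟨ interchange a K c L ⟩
  (a ℤ.* c) ℤ.* (K ℤ.* L)       ≡⟨ cong ((a ℤ.* c) ℤ.*_) (ℤₚ.pos-* (suc k) (suc l)) ⟨
  (a ℤ.* c) ℤ.* + (suc k ℕ.* suc l) ∎)
  where
  open ≡-Reasoning
  K L : ℤ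
  K = + suc k
  L = + suc l

≐-neg : ∀ {p a b} → p ≐ a ÷ b → Q.- p ≐ ℤ.- a ÷ b
≐-neg {mkℚᵘ m k} {a} {b} (mk≐ b≢0 mb≡aK) = mk≐ b≢0 (begin
  ℤ.- m ℤ.* b         ≡⟨ ℤₚ.neg-distribˡ-* m b ⟨
  ℤ.- (m ℤ.* b)       ≡⟨ cong ℤ.-_ mb≡aK ⟩
  ℤ.- (a ℤ.* + suc k) ≡⟨ ℤₚ.neg-distribˡ-* a (+ suc k) ⟩
  ℤ.- a ℤ.* + suc k   ∎)
  where open ≡-Reasoning

≐-cross : ∀ {p a b a′ b′} → p ≐ a ÷ b → b′ ≢ + 0 → a ℤ.* b′ ≡ a′ ℤ.* b → p ≐ a′ ÷ b′
≐-cross {p} {a} {b} {a′} {b′} (mk≐ b≢0 pb≡a) b′≢0 ab′≡a′b = mk≐ b′≢0 (ℤₚ.*-cancelʳ-≡ _ _ b {{ℤ.≢-nonZero b≢0}} (begin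
  ↥ p ℤ.* b′ ℤ.* b   ≡⟨ xy∙z≈xz∙y (↥ p) b′ b ⟩
  ↥ p ℤ.* b ℤ.* b′   ≡⟨ cong (ℤ._* b′) pb≡a ⟩
  a ℤ.* ↧ p ℤ.* b′   ≡⟨ xy∙z≈xz∙y a (↧ p) b′ ⟩
  a ℤ.* b′ ℤ.* ↧ p   ≡⟨ cong (ℤ._* ↧ p) ab′≡a′b ⟩
  a′ ℤ.* b ℤ.* ↧ p   ≡⟨ xy∙z≈xz∙y a′ b (↧ p) ⟩
  a′ ℤ.* ↧ p ℤ.* b   ∎))
  where open ≡-Reasoning

≐-scale : ∀ {p a b b′} → p ≐ a ÷ b → ∀ c → c ≢ + 0 → c ℤ.* b ≡ b′ → p ≐ (c ℤ.* a) ÷ b′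
≐-scale {p} {a} {b} {b′} (mk≐ b≢0 pb≡a) c c≢0 cb≡b′ = mk≐ (subst (_≢ + 0) cb≡b′ (*-≢0 c≢0 b≢0)) (begin
  ↥ p ℤ.* b′          ≡⟨ cong (↥ p ℤ.*_) cb≡b′ ⟨
  ↥ p ℤ.* (c ℤ.* b)   ≡⟨ x∙yz≈y∙xz (↥ p) c b ⟩
  c ℤ.* (↥ p ℤ.* b)   ≡⟨ cong (c ℤ.*_) pb≡a ⟩
  c ℤ.* (a ℤ.* ↧ p)   ≡⟨ ℤₚ.*-assoc c a (↧ p) ⟨
  c ℤ.* a ℤ.* ↧ p     ∎)
  where open ≡-Reasoning

≐-+-same : ∀ {p q a c b} → p ≐ a ÷ b → q ≐ c ÷ b → p Q.+ q ≐ (a ℤ.+ c) ÷ b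
≐-+-same {a = a} {c} {b} p≐ q≐ = ≐-cross (≐-+ p≐ q≐) (_≐_÷_.denominator≢0 p≐) (ring a c b)
  where
  ring : ∀ a c b → (a ℤ.* b ℤ.+ c ℤ.* b) ℤ.* b ≡ (a ℤ.+ c) ℤ.* (b ℤ.* b)
  ring = solve-∀

≐-−-same : ∀ {p q a c b} → p ≐ a ÷ b → q ≐ c ÷ b → p Q.- q ≐ (a ℤ.- c) ÷ b
≐-−-same p≐ q≐ = ≐-+-same p≐ (≐-neg q≐)

≐-integer : ∀ {p b} z → p ≐ (z ℤ.* b) ÷ b → p ≃ z Q./ 1
≐-integer {p} {b} z (mk≐ b≢0 pb≡zbp) = *≡* (begin
  ↥ p ℤ.* + 1  ≡⟨ ℤₚ.*-identityʳ (↥ p) ⟩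
  ↥ p          ≡⟨ ℤₚ.*-cancelʳ-≡ _ _ b {{ℤ.≢-nonZero b≢0}} (trans pb≡zbp (xy∙z≈xz∙y z b (↧ p))) ⟩
  z ℤ.* ↧ p    ∎)
  where open ≡-Reasoning

-- The exponent of ω_{h,K}

signBit : ℤ → ℤ
signBit (+ _)    = + 0
signBit -[1+ _ ] = + 1

signExp-≐ : ∀ v → signExp v ≐ signBit v ÷ + 2
signExp-≐ (+ _)    = mk≐ (λ ()) refl
signExp-≐ -[1+ _ ] = mk≐ (λ ()) refl

infixl 6 _⊕_

_⊕_ : ℤ → ℤ → ℤ
x ⊕ y = x ℤ.+ y ℤ.- + 2 ℤ.* x ℤ.* y
{-# INLINE _⊕_ #-}

signBit-* : ∀ {i j} → i ≢ + 0 → j ≢ + 0 → signBit (i ℤ.* j) ≡ signBit i ⊕ signBit j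
signBit-* {+ zero}   i≢0 _ = contradiction refl i≢0
signBit-* {j = + zero} _ j≢0 = contradiction refl j≢0
signBit-* {+ suc _}  {+ suc _}  _ _ = refl
signBit-* {+ suc _}  { -[1+ _ ]} _ _ = refl
signBit-* { -[1+ _ ]} {+ suc _}  _ _ = refl
signBit-* { -[1+ _ ]} { -[1+ _ ]} _ _ = refl

signBit-neg : ∀ {i} → i ≢ + 0 → signBit (ℤ.- i) ≡ + 1 ℤ.- signBit i
signBit-neg {+ zero}  i≢0 = contradiction refl i≢0
signBit-neg {+ suc _}  _  = refl
signBit-neg { -[1+ _ ]} _ = refl

-- 96K times the part of the exponent of ω_{h,K} (h odd) that does not come from the Kronecker symbol.
-- This and the other INLINE definitions are unfolded during elaboration, so the ring solver sees through them.
phaseNumerator : ℤ → ℤ → ℤ → ℤ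
phaseNumerator h K s = + 12 ℤ.* K ℤ.* (+ 2 ℤ.- h ℤ.* K ℤ.- h) ℤ.+ + 4 ℤ.* (K ℤ.* K ℤ.- + 1) ℤ.* (+ 2 ℤ.* h ℤ.- s ℤ.+ h ℤ.* h ℤ.* s)
{-# INLINE phaseNumerator #-}

omegaNumerator : ℤ → ℤ → ℤ → ℤ → ℤ
omegaNumerator h K σ s = + 48 ℤ.* K ℤ.* σ ℤ.- phaseNumerator h K s
{-# INLINE omegaNumerator #-}

omegaExp-≐ : ∀ h K .{{_ : ℕ.NonZero K}} → isOdd h ≡ true →
             omegaExp h K ≐ omegaNumerator h (+ K) (signBit (kronecker (ℤ.- + K) h)) (hStar h K) ÷ (+ 96 ℤ.* + K)
omegaExp-≐ h (suc K′) h-odd rewrite h-odd = oddBranch (+ suc K′) refl (signExp-≐ (kronecker (ℤ.- + suc K′) h))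
  where
  oddBranch : ∀ {σ g s} K → K ≡ + suc K′ → σ ≐ g ÷ + 2 →
    σ Q.- frac (+ 1) 2 Q.* (frac (+ 2 ℤ.- h ℤ.* K ℤ.- h) 4 Q.+ (frac K 1 Q.- frac (+ 1) (suc K′)) Q.* frac (+ 2 ℤ.* h ℤ.- s ℤ.+ h ℤ.* h ℤ.* s) 12)
      ≐ omegaNumerator h K g s ÷ (+ 96 ℤ.* K)
  oddBranch {g = g} {s} K K≡ σ≐ = ≐-cross
    (≐-+ σ≐ (≐-neg (≐-* (frac-≐ (+ 1) 2) (≐-+ (frac-≐ (+ 2 ℤ.- h ℤ.* K ℤ.- h) 4)
       (≐-* (≐-+ (frac-≐ K 1) (≐-neg 1/K≐)) (frac-≐ (+ 2 ℤ.* h ℤ.- s ℤ.+ h ℤ.* h ℤ.* s) 12))))))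
    (subst (λ K → + 96 ℤ.* K ≢ + 0) (sym K≡) (λ ()))
    (solve (g ∷ h ∷ K ∷ s ∷ []))
    where
    1/K≐ : frac (+ 1) (suc K′) ≐ + 1 ÷ K
    1/K≐ = subst (λ d → frac (+ 1) (suc K′) ≐ + 1 ÷ d) (sym K≡) (frac-≐ (+ 1) (suc K′))

-- Changing s by K t changes phaseNumerator by 4(K² - 1)(h² - 1)K t, a multiple of 96K when h is odd and 3 ∤ K.
omegaNumerator-shift : ∀ h K g x t α β → h ℤ.* h ≡ + 1 ℤ.+ + 8 ℤ.* α → K ℤ.* K ≡ + 1 ℤ.+ + 3 ℤ.* β →
  omegaNumerator h K g (x ℤ.+ K ℤ.* t) ≡ omegaNumerator h K (g ℤ.+ + 2 ℤ.* ℤ.- (α ℤ.* β ℤ.* t)) x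
omegaNumerator-shift h K g x t α β h²≡ K²≡ = begin
  omegaNumerator h K g (x ℤ.+ K ℤ.* t)
    ≡⟨ solve (h ∷ K ∷ g ∷ x ∷ t ∷ []) ⟩
  omegaNumerator h K g x ℤ.- + 4 ℤ.* (K ℤ.* K ℤ.- + 1) ℤ.* (h ℤ.* h ℤ.- + 1) ℤ.* (K ℤ.* t)
    ≡⟨ cong₂ (λ k² h² → omegaNumerator h K g x ℤ.- + 4 ℤ.* (k² ℤ.- + 1) ℤ.* (h² ℤ.- + 1) ℤ.* (K ℤ.* t)) K²≡ h²≡ ⟩
  omegaNumerator h K g x ℤ.- + 4 ℤ.* ((+ 1 ℤ.+ + 3 ℤ.* β) ℤ.- + 1) ℤ.* ((+ 1 ℤ.+ + 8 ℤ.* α) ℤ.- + 1) ℤ.* (K ℤ.* t)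
    ≡⟨ solve (h ∷ K ∷ g ∷ x ∷ t ∷ α ∷ β ∷ []) ⟩
  omegaNumerator h K (g ℤ.+ + 2 ℤ.* ℤ.- (α ℤ.* β ℤ.* t)) x ∎
  where open ≡-Reasoning

-- ω has the shape of the exponent of ω_{h,K}, with the sign bit σ taken modulo 2 and any inverse x of h mod K
-- in place of h*.
OmegaExponent : ℚᵘ → ℤ → ℤ → ℤ → ℤ → Set
OmegaExponent ω h K σ x = ∃ λ w → ω ≐ omegaNumerator h K (σ ℤ.+ + 2 ℤ.* w) x ÷ (+ 96 ℤ.* K)

omegaExp-exponent : ∀ h K x .{{_ : ℕ.NonZero K}} → ¬ 2 ∣ℕ ∣ h ∣ → ¬ 3 ∣ℕ K → + K ℤ∣.∣ h ℤ.* x ℤ.+ + 1 →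
  OmegaExponent (omegaExp h K) h (+ K) (signBit (kronecker (ℤ.- + K) h)) x
omegaExp-exponent h K x h-odd 3∤K K∣hx+1 =
  let t , h*≡x+Kt = inverses-congruent {+ K} {h} {hStar h K} {x} (hStar-inverse h K x K∣hx+1) K∣hx+1
      α , h²≡     = odd-square h h-odd
      β , K²≡     = square-prime-to-3 K 3∤K
      g           = signBit (kronecker (ℤ.- + K) h)
  in ℤ.- (α ℤ.* β ℤ.* t) ,
     subst (λ n → omegaExp h K ≐ n ÷ (+ 96 ℤ.* + K))
       (trans (cong (omegaNumerator h (+ K) g) h*≡x+Kt) (omegaNumerator-shift h (+ K) g x t α β h²≡ K²≡))
       (omegaExp-≐ h K (isOdd-true h h-odd))

-- The two identities

numerator-identity₁ : ∀ {s₁ s₄} K k h u m e g₂ g₃ w₁ w₂ w₃ w₄ → k ≡ + 2 ℤ.* K → s₁ ≡ e ⊕ g₂ → s₄ ≡ (+ 1 ℤ.- e) ⊕ g₃ →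
  h ℤ.* (u ℤ.* + 3) ℤ.+ + 1 ≡ m ℤ.* (+ 4 ℤ.* k) → ∃ λ z →
  + 6 ℤ.* omegaNumerator (+ 3 ℤ.* h) K (s₁ ℤ.+ + 2 ℤ.* w₁) u ℤ.+ + 6 ℤ.* omegaNumerator h K (g₂ ℤ.+ + 2 ℤ.* w₂) (u ℤ.* + 3)
  ℤ.+ + 3 ℤ.* omegaNumerator h k (g₃ ℤ.+ + 2 ℤ.* w₃) (u ℤ.* + 3)
  ℤ.- + 3 ℤ.* omegaNumerator (+ 3 ℤ.* h) k (s₄ ℤ.+ + 2 ℤ.* w₄) u
  ℤ.- + 8 ℤ.* (h ℤ.* (+ 9 ℤ.+ + 9 ℤ.* k) ℤ.+ (u ℤ.* + 3) ℤ.* (ℤ.- + 5 ℤ.+ + 2 ℤ.* (k ℤ.* k)))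
  ≡ z ℤ.* (+ 576 ℤ.* K)
numerator-identity₁ K k h u m e g₂ g₃ w₁ w₂ w₃ w₄ refl refl refl inverse =
  e ℤ.+ g₂ ℤ.+ g₃ ℤ.- e ℤ.* g₂ ℤ.- e ℤ.* g₃ ℤ.- + 1 ℤ.+ w₁ ℤ.+ w₂ ℤ.+ w₃ ℤ.- w₄ ℤ.+ h ℤ.* m , (begin
  _ ≡⟨ solve (K ∷ h ∷ u ∷ e ∷ g₂ ∷ g₃ ∷ w₁ ∷ w₂ ∷ w₃ ∷ w₄ ∷ []) ⟩
  (e ℤ.+ g₂ ℤ.+ g₃ ℤ.- e ℤ.* g₂ ℤ.- e ℤ.* g₃ ℤ.- + 1 ℤ.+ w₁ ℤ.+ w₂ ℤ.+ w₃ ℤ.- w₄) ℤ.* (+ 576 ℤ.* K)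
    ℤ.+ + 72 ℤ.* h ℤ.* (h ℤ.* (u ℤ.* + 3) ℤ.+ + 1)
    ≡⟨ cong (λ x → (e ℤ.+ g₂ ℤ.+ g₃ ℤ.- e ℤ.* g₂ ℤ.- e ℤ.* g₃ ℤ.- + 1 ℤ.+ w₁ ℤ.+ w₂ ℤ.+ w₃ ℤ.- w₄) ℤ.* (+ 576 ℤ.* K) ℤ.+ + 72 ℤ.* h ℤ.* x) inverse ⟩
  (e ℤ.+ g₂ ℤ.+ g₃ ℤ.- e ℤ.* g₂ ℤ.- e ℤ.* g₃ ℤ.- + 1 ℤ.+ w₁ ℤ.+ w₂ ℤ.+ w₃ ℤ.- w₄) ℤ.* (+ 576 ℤ.* K)
    ℤ.+ + 72 ℤ.* h ℤ.* (m ℤ.* (+ 4 ℤ.* (+ 2 ℤ.* K)))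
    ≡⟨ solve (K ∷ h ∷ m ∷ e ∷ g₂ ∷ g₃ ∷ w₁ ∷ w₂ ∷ w₃ ∷ w₄ ∷ []) ⟩
  _ ∎)
  where open ≡-Reasoning

numerator-identity₂ : ∀ {s₁ s₄} K k h u m e g₂ g₃ w₁ w₂ w₃ w₄ → k ≡ + 2 ℤ.* K → s₁ ≡ e ⊕ g₂ → s₄ ≡ (+ 1 ℤ.- e) ⊕ g₃ →
  h ℤ.* (u ℤ.* + 3) ℤ.+ + 1 ≡ m ℤ.* (+ 4 ℤ.* k) → ∃ λ z →
  + 3 ℤ.* omegaNumerator (+ 3 ℤ.* h) k (s₄ ℤ.+ + 2 ℤ.* w₄) u ℤ.+ + 6 ℤ.* omegaNumerator h K (g₂ ℤ.+ + 2 ℤ.* w₂) (u ℤ.* + 3)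
  ℤ.+ + 3 ℤ.* omegaNumerator h k (g₃ ℤ.+ + 2 ℤ.* w₃) (u ℤ.* + 3)
  ℤ.- + 6 ℤ.* (+ 3 ℤ.* omegaNumerator (+ 3 ℤ.* h) K (s₁ ℤ.+ + 2 ℤ.* w₁) u)
  ℤ.- (+ 288 ℤ.* K ℤ.* + 1 ℤ.- + 16 ℤ.* (h ℤ.* (+ 9 ℤ.+ + 9 ℤ.* k) ℤ.+ (u ℤ.* + 3) ℤ.* (+ 1 ℤ.- k ℤ.* k)))
  ≡ z ℤ.* (+ 576 ℤ.* K)
numerator-identity₂ K k h u m e g₂ g₃ w₁ w₂ w₃ w₄ refl refl refl inverse =
  + 3 ℤ.* e ℤ.* g₂ ℤ.+ e ℤ.* g₃ ℤ.- + 2 ℤ.* e ℤ.- g₂ ℤ.- + 3 ℤ.* w₁ ℤ.+ w₂ ℤ.+ w₃ ℤ.+ w₄ ℤ.- + 2 ℤ.* h ℤ.* m , (begin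
  _ ≡⟨ solve (K ∷ h ∷ u ∷ e ∷ g₂ ∷ g₃ ∷ w₁ ∷ w₂ ∷ w₃ ∷ w₄ ∷ []) ⟩
  (+ 3 ℤ.* e ℤ.* g₂ ℤ.+ e ℤ.* g₃ ℤ.- + 2 ℤ.* e ℤ.- g₂ ℤ.- + 3 ℤ.* w₁ ℤ.+ w₂ ℤ.+ w₃ ℤ.+ w₄) ℤ.* (+ 576 ℤ.* K)
    ℤ.- + 144 ℤ.* h ℤ.* (h ℤ.* (u ℤ.* + 3) ℤ.+ + 1)
    ≡⟨ cong (λ x → (+ 3 ℤ.* e ℤ.* g₂ ℤ.+ e ℤ.* g₃ ℤ.- + 2 ℤ.* e ℤ.- g₂ ℤ.- + 3 ℤ.* w₁ ℤ.+ w₂ ℤ.+ w₃ ℤ.+ w₄) ℤ.* (+ 576 ℤ.* K) ℤ.- + 144 ℤ.* h ℤ.* x) inverse ⟩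
  (+ 3 ℤ.* e ℤ.* g₂ ℤ.+ e ℤ.* g₃ ℤ.- + 2 ℤ.* e ℤ.- g₂ ℤ.- + 3 ℤ.* w₁ ℤ.+ w₂ ℤ.+ w₃ ℤ.+ w₄) ℤ.* (+ 576 ℤ.* K)
    ℤ.- + 144 ℤ.* h ℤ.* (m ℤ.* (+ 4 ℤ.* (+ 2 ℤ.* K)))
    ≡⟨ solve (K ∷ h ∷ m ∷ e ∷ g₂ ∷ g₃ ∷ w₁ ∷ w₂ ∷ w₃ ∷ w₄ ∷ []) ⟩
  _ ∎)
  where open ≡-Reasoning

common-denominator₁ : ∀ {ω₁ ω₂ ω₃ ω₄ r n₁ n₂ n₃ n₄ N} K k → k ≡ + 2 ℤ.* K →
  ω₁ ≐ n₁ ÷ (+ 96 ℤ.* K) → ω₂ ≐ n₂ ÷ (+ 96 ℤ.* K) → ω₃ ≐ n₃ ÷ (+ 96 ℤ.* k) → ω₄ ≐ n₄ ÷ (+ 96 ℤ.* k) →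
  r ≐ N ÷ (+ 36 ℤ.* k) →
  ω₁ Q.+ ω₂ Q.+ ω₃ Q.- ω₄ Q.- r ≐ (+ 6 ℤ.* n₁ ℤ.+ + 6 ℤ.* n₂ ℤ.+ + 3 ℤ.* n₃ ℤ.- + 3 ℤ.* n₄ ℤ.- + 8 ℤ.* N) ÷ (+ 576 ℤ.* K)
common-denominator₁ K k refl ω₁≐ ω₂≐ ω₃≐ ω₄≐ r≐ =
  ≐-−-same (≐-−-same (≐-+-same (≐-+-same (≐-scale ω₁≐ (+ 6) (λ ()) (solve (K ∷ [])))
                                         (≐-scale ω₂≐ (+ 6) (λ ()) (solve (K ∷ []))))
                               (≐-scale ω₃≐ (+ 3) (λ ()) (solve (K ∷ []))))
                     (≐-scale ω₄≐ (+ 3) (λ ()) (solve (K ∷ []))))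
           (≐-scale r≐ (+ 8) (λ ()) (solve (K ∷ [])))

common-denominator₂ : ∀ {ω₁ ω₂ ω₃ ω₄ r n₁ n₂ n₃ n₄ N} K k → k ≡ + 2 ℤ.* K → K ≢ + 0 →
  ω₁ ≐ n₁ ÷ (+ 96 ℤ.* K) → ω₂ ≐ n₂ ÷ (+ 96 ℤ.* K) → ω₃ ≐ n₃ ÷ (+ 96 ℤ.* k) → ω₄ ≐ n₄ ÷ (+ 96 ℤ.* k) →
  r ≐ N ÷ (+ 18 ℤ.* k) →
  ω₄ Q.+ ω₂ Q.+ ω₃ Q.- frac (+ 3) 1 Q.* ω₁ Q.- (frac (+ 1) 2 Q.- r)
    ≐ (+ 3 ℤ.* n₄ ℤ.+ + 6 ℤ.* n₂ ℤ.+ + 3 ℤ.* n₃ ℤ.- + 6 ℤ.* (+ 3 ℤ.* n₁) ℤ.- (+ 288 ℤ.* K ℤ.* + 1 ℤ.- + 16 ℤ.* N)) ÷ (+ 576 ℤ.* K)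
common-denominator₂ K k refl K≢0 ω₁≐ ω₂≐ ω₃≐ ω₄≐ r≐ =
  ≐-−-same (≐-−-same (≐-+-same (≐-+-same (≐-scale ω₄≐ (+ 3) (λ ()) (solve (K ∷ [])))
                                         (≐-scale ω₂≐ (+ 6) (λ ()) (solve (K ∷ []))))
                               (≐-scale ω₃≐ (+ 3) (λ ()) (solve (K ∷ []))))
                     (≐-scale (≐-* (frac-≐ (+ 3) 1) ω₁≐) (+ 6) (λ ()) (solve (K ∷ []))))
           (≐-−-same (≐-scale (frac-≐ (+ 1) 2) (+ 288 ℤ.* K) (*-≢0 {+ 288} (λ ()) K≢0) (solve (K ∷ [])))
                     (≐-scale r≐ (+ 16) (λ ()) (solve (K ∷ []))))

≐⇒≡₁ : ∀ {x y a b} → (∃ λ z → a ≡ z ℤ.* b) → x Q.- y ≐ a ÷ b → x ≡₁ y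
≐⇒≡₁ {x} {y} {b = b} (z , a≡zb) x-y≐ = z , ≐-integer z (subst (λ n → x Q.- y ≐ n ÷ b) a≡zb x-y≐)

omega-fractions⇒identity₁ : ∀ {ω₁ ω₂ ω₃ ω₄ r s₁ s₄} K k h u m e g₂ g₃ → k ≡ + 2 ℤ.* K →
  s₁ ≡ e ⊕ g₂ → s₄ ≡ (+ 1 ℤ.- e) ⊕ g₃ → h ℤ.* (u ℤ.* + 3) ℤ.+ + 1 ≡ m ℤ.* (+ 4 ℤ.* k) →
  OmegaExponent ω₁ (+ 3 ℤ.* h) K s₁ u → OmegaExponent ω₂ h K g₂ (u ℤ.* + 3) →
  OmegaExponent ω₃ h k g₃ (u ℤ.* + 3) → OmegaExponent ω₄ (+ 3 ℤ.* h) k s₄ u →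
  r ≐ h ℤ.* (+ 9 ℤ.+ + 9 ℤ.* k) ℤ.+ (u ℤ.* + 3) ℤ.* (ℤ.- + 5 ℤ.+ + 2 ℤ.* (k ℤ.* k)) ÷ (+ 36 ℤ.* k) →
  ω₁ Q.+ ω₂ Q.+ ω₃ Q.- ω₄ ≡₁ r
omega-fractions⇒identity₁ {ω₁} {ω₂} {ω₃} {ω₄} {r} K k h u m e g₂ g₃ k≡2K s₁≡ s₄≡ inverse
  (w₁ , ω₁≐) (w₂ , ω₂≐) (w₃ , ω₃≐) (w₄ , ω₄≐) r≐ =
  ≐⇒≡₁ {ω₁ Q.+ ω₂ Q.+ ω₃ Q.- ω₄} {r} (numerator-identity₁ K k h u m e g₂ g₃ w₁ w₂ w₃ w₄ k≡2K s₁≡ s₄≡ inverse)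
    (common-denominator₁ K k k≡2K ω₁≐ ω₂≐ ω₃≐ ω₄≐ r≐)

omega-fractions⇒identity₂ : ∀ {ω₁ ω₂ ω₃ ω₄ r s₁ s₄} K k h u m e g₂ g₃ → k ≡ + 2 ℤ.* K → K ≢ + 0 →
  s₁ ≡ e ⊕ g₂ → s₄ ≡ (+ 1 ℤ.- e) ⊕ g₃ → h ℤ.* (u ℤ.* + 3) ℤ.+ + 1 ≡ m ℤ.* (+ 4 ℤ.* k) →
  OmegaExponent ω₁ (+ 3 ℤ.* h) K s₁ u → OmegaExponent ω₂ h K g₂ (u ℤ.* + 3) →
  OmegaExponent ω₃ h k g₃ (u ℤ.* + 3) → OmegaExponent ω₄ (+ 3 ℤ.* h) k s₄ u →
  r ≐ h ℤ.* (+ 9 ℤ.+ + 9 ℤ.* k) ℤ.+ (u ℤ.* + 3) ℤ.* (+ 1 ℤ.- k ℤ.* k) ÷ (+ 18 ℤ.* k) →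
  ω₄ Q.+ ω₂ Q.+ ω₃ Q.- frac (+ 3) 1 Q.* ω₁ ≡₁ frac (+ 1) 2 Q.- r
omega-fractions⇒identity₂ {ω₁} {ω₂} {ω₃} {ω₄} {r} K k h u m e g₂ g₃ k≡2K K≢0 s₁≡ s₄≡ inverse
  (w₁ , ω₁≐) (w₂ , ω₂≐) (w₃ , ω₃≐) (w₄ , ω₄≐) r≐ =
  ≐⇒≡₁ {ω₄ Q.+ ω₂ Q.+ ω₃ Q.- frac (+ 3) 1 Q.* ω₁} {frac (+ 1) 2 Q.- r}
    (numerator-identity₂ K k h u m e g₂ g₃ w₁ w₂ w₃ w₄ k≡2K s₁≡ s₄≡ inverse)
    (common-denominator₂ K k k≡2K K≢0 ω₁≐ ω₂≐ ω₃≐ ω₄≐ r≐)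

prime[3] : Prime 3
prime[3] = toWitness {a? = prime? 3} tt

prime∤⇒coprime : ∀ {p n} → Prime p → ¬ p ∣ℕ n → Coprime n p
prime∤⇒coprime p-prime p∤n (d∣n , d∣p) with prime⇒irreducible p-prime d∣p
... | inj₁ d≡1 = d≡1
... | inj₂ refl = contradiction d∣n p∤n

module _ {K′ : ℕ} {h u m : ℤ} (3∤k : ¬ 3 ∣ℕ 2 ℕ.* suc K′) (coprime : Coprime ∣ h ∣ (2 ℕ.* suc K′))
         (inverse : h ℤ.* (u ℤ.* + 3) ℤ.+ + 1 ≡ m ℤ.* + (4 ℕ.* (2 ℕ.* suc K′))) where

  private
    K k : ℕ
    K = suc K′
    k = 2 ℕ.* K

    3∤K : ¬ 3 ∣ℕ K
    3∤K 3∣K = 3∤k (ℕ∣.∣n⇒∣m*n 2 3∣K)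

    h-odd : ¬ 2 ∣ℕ ∣ h ∣
    h-odd 2∣h with coprime (2∣h , ℕ∣.m∣m*n K)
    ... | ()

    3h-odd : ¬ 2 ∣ℕ ∣ + 3 ℤ.* h ∣
    3h-odd = odd-* (+ 3) h (toWitnessFalse {a? = 2 ∣? 3} tt) h-odd

    h≢0 : h ≢ + 0
    h≢0 refl = h-odd (ℕ∣._∣0 2)

    K∣h[3u]+1 : + K ℤ∣.∣ h ℤ.* (u ℤ.* + 3) ℤ.+ + 1
    K∣h[3u]+1 = ℤ∣.divides (m ℤ.* + 8) (trans inverse (ring m (+ K)))
      where
      ring : ∀ m K → m ℤ.* (+ 4 ℤ.* (+ 2 ℤ.* K)) ≡ m ℤ.* + 8 ℤ.* K
      ring = solve-∀

    k∣h[3u]+1 : + k ℤ∣.∣ h ℤ.* (u ℤ.* + 3) ℤ.+ + 1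
    k∣h[3u]+1 = ℤ∣.divides (m ℤ.* + 4) (trans inverse (ring m (+ k)))
      where
      ring : ∀ m k → m ℤ.* (+ 4 ℤ.* k) ≡ m ℤ.* + 4 ℤ.* k
      ring = solve-∀

    [3h]u≡h[3u] : + 3 ℤ.* h ℤ.* u ℤ.+ + 1 ≡ h ℤ.* (u ℤ.* + 3) ℤ.+ + 1
    [3h]u≡h[3u] = solve (h ∷ u ∷ [])

    e : ℤ
    e = signBit (kronNat (ℤ.- + K) 3)

    kronNat-3≢0 : kronNat (ℤ.- + K) 3 ≢ + 0
    kronNat-3≢0 = kronecker-≢0 (ℤ.- + K) (+ 3) (prime∤⇒coprime prime[3] 3∤K)

    signBit-3h-K : signBit (kronecker (ℤ.- + K) (+ 3 ℤ.* h)) ≡ e ⊕ signBit (kronecker (ℤ.- + K) h)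
    signBit-3h-K = trans (cong signBit (kronecker-*-prime (ℤ.- + K) h prime[3] h≢0))
      (signBit-* kronNat-3≢0 (kronecker-≢0 (ℤ.- + K) h (λ (d∣K , d∣h) → coprime (d∣h , ℕ∣.∣-trans d∣K (ℕ∣.n∣m*n 2)))))

    signBit-3h-k : signBit (kronecker (ℤ.- + k) (+ 3 ℤ.* h)) ≡ (+ 1 ℤ.- e) ⊕ signBit (kronecker (ℤ.- + k) h)
    signBit-3h-k = begin
      signBit (kronecker (ℤ.- + k) (+ 3 ℤ.* h))                        ≡⟨ cong signBit (kronecker-*-prime (ℤ.- + k) h prime[3] h≢0) ⟩
      signBit (kronNat (ℤ.- + k) 3 ℤ.* kronecker (ℤ.- + k) h)          ≡⟨ cong (λ c → signBit (c ℤ.* kronecker (ℤ.- + k) h)) (kronNat-3-neg-double K 3∤K) ⟩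
      signBit (ℤ.- kronNat (ℤ.- + K) 3 ℤ.* kronecker (ℤ.- + k) h)      ≡⟨ signBit-* (kronNat-3≢0 ∘ ℤₚ.neg-injective) (kronecker-≢0 (ℤ.- + k) h (Coprime.sym coprime)) ⟩
      signBit (ℤ.- kronNat (ℤ.- + K) 3) ⊕ signBit (kronecker (ℤ.- + k) h) ≡⟨ cong (_⊕ signBit (kronecker (ℤ.- + k) h)) (signBit-neg kronNat-3≢0) ⟩
      (+ 1 ℤ.- e) ⊕ signBit (kronecker (ℤ.- + k) h)                    ∎
      where open ≡-Reasoning

    ω-3h-K : OmegaExponent (omegaExp (+ 3 ℤ.* h) K) (+ 3 ℤ.* h) (+ K) (signBit (kronecker (ℤ.- + K) (+ 3 ℤ.* h))) u
    ω-3h-K = omegaExp-exponent (+ 3 ℤ.* h) K u 3h-odd 3∤K (subst (+ K ℤ∣.∣_) (sym [3h]u≡h[3u]) K∣h[3u]+1)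

    ω-h-K : OmegaExponent (omegaExp h K) h (+ K) (signBit (kronecker (ℤ.- + K) h)) (u ℤ.* + 3)
    ω-h-K = omegaExp-exponent h K (u ℤ.* + 3) h-odd 3∤K K∣h[3u]+1

    ω-h-k : OmegaExponent (omegaExp h k) h (+ k) (signBit (kronecker (ℤ.- + k) h)) (u ℤ.* + 3)
    ω-h-k = omegaExp-exponent h k (u ℤ.* + 3) h-odd 3∤k k∣h[3u]+1

    ω-3h-k : OmegaExponent (omegaExp (+ 3 ℤ.* h) k) (+ 3 ℤ.* h) (+ k) (signBit (kronecker (ℤ.- + k) (+ 3 ℤ.* h))) u
    ω-3h-k = omegaExp-exponent (+ 3 ℤ.* h) k u 3h-odd 3∤k (subst (+ k ℤ∣.∣_) (sym [3h]u≡h[3u]) k∣h[3u]+1)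

  omega-identity₁ : omegaExp (+ 3 ℤ.* h) K Q.+ omegaExp h K Q.+ omegaExp h k Q.- omegaExp (+ 3 ℤ.* h) k
      ≡₁ frac (h ℤ.* (+ 9 ℤ.+ + 9 ℤ.* + k) ℤ.+ (u ℤ.* + 3) ℤ.* (ℤ.- + 5 ℤ.+ + 2 ℤ.* (+ k ℤ.* + k))) (36 ℕ.* k)
  omega-identity₁ = omega-fractions⇒identity₁ (+ K) (+ k) h u m e _ _ refl signBit-3h-K signBit-3h-k inverse
    ω-3h-K ω-h-K ω-h-k ω-3h-k (frac-≐ _ _)

  omega-identity₂ : omegaExp (+ 3 ℤ.* h) k Q.+ omegaExp h K Q.+ omegaExp h k Q.- frac (+ 3) 1 Q.* omegaExp (+ 3 ℤ.* h) K
      ≡₁ frac (+ 1) 2 Q.- frac (h ℤ.* (+ 9 ℤ.+ + 9 ℤ.* + k) ℤ.+ (u ℤ.* + 3) ℤ.* (+ 1 ℤ.- + k ℤ.* + k)) (18 ℕ.* k)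
  omega-identity₂ = omega-fractions⇒identity₂ (+ K) (+ k) h u m e _ _ refl (λ ()) signBit-3h-K signBit-3h-k inverse
    ω-3h-K ω-h-K ω-h-k ω-3h-k (frac-≐ _ _)

gcd[k,6]≡2⇒k≡2[1+K] : ∀ k → gcd k 6 ≡ 2 → ∃ λ K′ → k ≡ 2 ℕ.* suc K′
gcd[k,6]≡2⇒k≡2[1+K] k gcd≡2 with subst (_∣ℕ k) gcd≡2 (gcd[m,n]∣m k 6)
... | ℕ∣.divides zero    refl = contradiction gcd≡2 λ ()
... | ℕ∣.divides (suc K′) k≡ = K′ , trans k≡ (ℕₚ.*-comm (suc K′) 2)

gcd[k,6]≡2⇒3∤k : ∀ k → gcd k 6 ≡ 2 → ¬ 3 ∣ℕ k
gcd[k,6]≡2⇒3∤k k gcd≡2 3∣k with subst (3 ∣ℕ_) gcd≡2 (gcd-greatest 3∣k (ℕ∣.divides 2 refl))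
... | ℕ∣.divides (suc q) ()

[2n]/2≡n : ∀ n → 2 ℕ.* n / 2 ≡ n
[2n]/2≡n n = trans (cong (_/ 2) (ℕₚ.*-comm 2 n)) (ℕD.m*n/n≡m n 2)

lemma3p3 : (k : ℕ) (h h′ : ℤ) →
    gcd k 6 ≡ 2 →
    Coprime ∣ h ∣ k →
    + (4 ℕ.* k) ∣ (h ℤ.* h′ ℤ.+ + 1) →
    + 3 ∣ h′ →
    (omegaExp (+ 3 ℤ.* h) (k / 2) Q.+ omegaExp h (k / 2) Q.+ omegaExp h k Q.- omegaExp (+ 3 ℤ.* h) k
      ≡₁ frac (h ℤ.* (+ 9 ℤ.+ + 9 ℤ.* + k) ℤ.+ h′ ℤ.* (ℤ.- + 5 ℤ.+ + 2 ℤ.* (+ k ℤ.* + k))) (36 ℕ.* k))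
    ×
    (omegaExp (+ 3 ℤ.* h) k Q.+ omegaExp h (k / 2) Q.+ omegaExp h k Q.- frac (+ 3) 1 Q.* omegaExp (+ 3 ℤ.* h) (k / 2)
      ≡₁ frac (+ 1) 2 Q.- frac (h ℤ.* (+ 9 ℤ.+ + 9 ℤ.* + k) ℤ.+ h′ ℤ.* (+ 1 ℤ.- + k ℤ.* + k)) (18 ℕ.* k))
lemma3p3 k h h′ gcd≡2 coprime 4k∣hh′+1 3∣h′
  with gcd[k,6]≡2⇒k≡2[1+K] k gcd≡2 | ℤ∣.∣ᵤ⇒∣ {+ 3} {h′} 3∣h′ | ℤ∣.∣ᵤ⇒∣ {+ (4 ℕ.* k)} {h ℤ.* h′ ℤ.+ + 1} 4k∣hh′+1
... | K′ , refl | ℤ∣.divides u refl | ℤ∣.divides m inverse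
  rewrite [2n]/2≡n (suc K′) =
    omega-identity₁ {K′} {h} {u} {m} 3∤k coprime inverse , omega-identity₂ {K′} {h} {u} {m} 3∤k coprime inverse
  where
  3∤k : ¬ 3 ∣ℕ 2 ℕ.* suc K′
  3∤k = gcd[k,6]≡2⇒3∤k _ gcd≡2
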